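{- Every skeleton admits a unique perfect matching.
   Context: All graphs are finite. Path length = number of edges; a path is odd/even according to its length. A graph has degree $3$ if every vertex has degree at most $3$. A leaf is a vertex of degree $1$; a path is leaf-to-leaf if both end-vertices are leaves of $G$. If $p=e_1\cdots e_{2m+1}$ is an odd path, $e_j$ is odd if $j$ is odd and even otherwise. For a matching $N$, an $N,N^c$ alternating cycle is a cycle whose edges alternate between $N$ and $E\setminus N$. A connected nonempty graph $G=(V,E)$ is a skeleton if it has degree $3$ and admits a (not necessarily spanning) subgraph $G'=(V',E')$ such that: (i) the connected components of $G'$ are vertex-disjoint odd leaf-to-leaf paths of length at least $5$; (ii) for each odd edge of a component of $G'$, either both of its endpoints have $G$-degree $3$ (rich edges) or neither does; (iii) each component of $G'$ contains a vertex of $G$-degree $3$; (iv) every vertex of $V\setminus V'$ has $G$-degree at most $2$; (v) $G-V'$ consists of vertex-disjoint odd paths; (vi) letting $G''$ be $G$ with all rich edges deleted, the component in $G''$ of each end-vertex of each component of $G'$ is an even path, and these are the only components of $G''$ that are even paths; (vii) $G''$ is bipartite; (viii) letting $N$ be the matching consisting of the odd edges of the components of $G'$ and the odd edges of the components of $G-V'$, $G$ contains no $N,N^c$ alternating cycle. -}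

module Defs where

open import Data.Nat using (ℕ; zero; suc; _+_; _∸_; _≤_; _<_; _%_)
open import Data.Bool using (Bool; true; false)
open import Data.Fin using (Fin)
open import Data.List using (List; []; _∷_; _++_; _∷ʳ_; length; concat; map)
open import Data.List.Membership.Propositional using (_∈_; _∉_)
open import Data.List.Relation.Unary.All using (All)
open import Data.List.Relation.Unary.Unique.Propositional using (Unique)
open import Data.Product using (Σ; ∃; ∃-syntax; _×_; _,_)
open import Data.Sum using (_⊎_)
open import Relation.Binary.PropositionalEquality using (_≡_; _≢_)
open import Relation.Nullary using (¬_)
open import Data.Fin using (Fin)
open import Data.List using (allFin)

record Graph (n : ℕ) : Set where
  field
    adj   : Fin n → Fin n → Bool
    adj-sym : ∀ u v → adj u v ≡ adj v u
    adj-irr : ∀ u → adj u u ≡ false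

countTrue : List Bool → ℕ
countTrue [] = 0
countTrue (true ∷ bs) = suc (countTrue bs)
countTrue (false ∷ bs) = countTrue bs

VRel : ℕ → Set₁
VRel n = Fin n → Fin n → Set

pairs : {A : Set} → List A → List (A × A)
pairs [] = []
pairs (x ∷ []) = []
pairs (x ∷ y ∷ xs) = (x , y) ∷ pairs (y ∷ xs)

-- the odd edges e1, e3, e5, ... of a path given by its vertex list
oddPairs : {A : Set} → List A → List (A × A)
oddPairs (x ∷ y ∷ xs) = (x , y) ∷ oddPairs xs
oddPairs _ = []

cycPairs : {A : Set} → List A → List (A × A)
cycPairs [] = []
cycPairs (x ∷ xs) = pairs ((x ∷ xs) ∷ʳ x)

InE : {A : Set} → List (A × A) → A → A → Set
InE L u v = ((u , v) ∈ L) ⊎ ((v , u) ∈ L)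

OddN : ℕ → Set
OddN k = k % 2 ≡ 1

EvenN : ℕ → Set
EvenN k = k % 2 ≡ 0

pathLength : {A : Set} → List A → ℕ
pathLength p = length p ∸ 1

IsEnd : {A : Set} → List A → A → Set
IsEnd {A} p x = (∃[ r ] p ≡ x ∷ r) ⊎ (∃[ r ] p ≡ r ∷ʳ x)

data Reach {n : ℕ} (R : VRel n) : Fin n → Fin n → Set where
  here : ∀ {u} → Reach R u u
  step : ∀ {u v w} → R u v → Reach R v w → Reach R u w

IsPathIn : {n : ℕ} → VRel n → List (Fin n) → Set
IsPathIn R p = Unique p × All (λ e → R (Data.Product.proj₁ e) (Data.Product.proj₂ e)) (pairs p)

-- the connected component of x in the graph with edge relation R is an
-- even path: its vertex set is that of a path p in R, and every R-edge at a
-- vertex of p is an edge of p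
ComponentIsEvenPath : {n : ℕ} → VRel n → Fin n → Set
ComponentIsEvenPath R x =
  ∃[ p ] IsPathIn R p
       × (∀ v → (Reach R x v → v ∈ p) × (v ∈ p → Reach R x v))
       × (∀ u v → u ∈ p → R u v → InE (pairs p) u v)
       × EvenN (pathLength p)

module _ {n : ℕ} (G : Graph n) where
  open Graph G

  E : VRel n
  E u v = adj u v ≡ true

  deg : Fin n → ℕ
  deg u = countTrue (map (adj u) (allFin n))

  Connected : Set
  Connected = ∀ u v → Reach E u v

  MaxDeg3 : Set
  MaxDeg3 = ∀ u → deg u ≤ 3

  IsLeaf : Fin n → Set
  IsLeaf v = deg v ≡ 1

  -- Ps : the components of G' (vertex lists of paths)
  -- Qs : the components of G - V' (vertex lists of paths)
  -- rich edges of G'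
  Rich : List (List (Fin n)) → VRel n
  Rich Ps u v = ∃[ P ] P ∈ Ps × InE (oddPairs P) u v × deg u ≡ 3 × deg v ≡ 3

  E'' : List (List (Fin n)) → VRel n
  E'' Ps u v = E u v × ¬ Rich Ps u v

  N : List (List (Fin n)) → List (List (Fin n)) → VRel n
  N Ps Qs u v = ∃[ P ] P ∈ (Ps ++ Qs) × InE (oddPairs P) u v

  AltCycle : VRel n → List (Fin n) → Set
  AltCycle M c =
      3 ≤ length c
    × Unique c
    × All (λ e → E (Data.Product.proj₁ e) (Data.Product.proj₂ e)) (cycPairs c)
    × All (λ ef → Alt (Data.Product.proj₁ ef) (Data.Product.proj₂ ef)) (cycPairs (cycPairs c))
    where
      InM : Fin n × Fin n → Set
      InM (a , b) = M a b
      Alt : Fin n × Fin n → Fin n × Fin n → Set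
      Alt e f = (InM e × ¬ InM f) ⊎ (¬ InM e × InM f)

  record SkeletonWitness (Ps Qs : List (List (Fin n))) : Set where
    field
      -- (i) components of G' : vertex-disjoint odd leaf-to-leaf paths of length ≥ 5
      G'-disjoint  : Unique (concat Ps)
      G'-paths     : All (IsPathIn E) Ps
      G'-odd       : All (λ P → OddN (pathLength P)) Ps
      G'-long      : All (λ P → 5 ≤ pathLength P) Ps
      G'-leaves    : All (λ P → ∀ x → IsEnd P x → IsLeaf x) Ps
      G'-oddEdges  : All (λ P → All (λ e → (deg (Data.Product.proj₁ e) ≡ 3 × deg (Data.Product.proj₂ e) ≡ 3)
                                          ⊎ (deg (Data.Product.proj₁ e) ≢ 3 × deg (Data.Product.proj₂ e) ≢ 3))
                                   (oddPairs P)) Ps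
      G'-deg3      : All (λ P → ∃[ v ] v ∈ P × deg v ≡ 3) Ps
      -- (iv) vertices outside V' have degree ≤ 2
      outside-deg  : ∀ v → v ∉ concat Ps → deg v ≤ 2
      -- (v) G - V' consists of the vertex-disjoint odd paths Qs
      Q-disjoint   : Unique (concat Qs)
      Q-paths      : All (IsPathIn E) Qs
      Q-odd        : All (λ Q → OddN (pathLength Q)) Qs
      Q-cover      : ∀ v → (v ∈ concat Qs → v ∉ concat Ps) × (v ∉ concat Ps → v ∈ concat Qs)
      Q-induced    : ∀ u v → u ∉ concat Ps → v ∉ concat Ps → E u v →
                       ∃[ Q ] Q ∈ Qs × InE (pairs Q) u v
      ends-even    : All (λ P → ∀ x → IsEnd P x → ComponentIsEvenPath (E'' Ps) x) Ps
      only-even    : ∀ y → ComponentIsEvenPath (E'' Ps) y →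
                       ∃[ P ] P ∈ Ps × ∃[ x ] IsEnd P x × Reach (E'' Ps) x y
      bipartite    : Σ (Fin n → Bool) λ c → (∀ u v → E'' Ps u v → c u ≢ c v)
      -- (viii) no N,N^c alternating cycle
      noAltCycle   : ∀ c → ¬ AltCycle (N Ps Qs) c

  IsSkeleton : Set
  IsSkeleton = 0 < n × Connected × MaxDeg3 × ∃[ Ps ] ∃[ Qs ] SkeletonWitness Ps Qs

  IsPerfectMatching : (Fin n → Fin n → Bool) → Set
  IsPerfectMatching M =
      (∀ u v → M u v ≡ true → adj u v ≡ true)
    × (∀ u v → M u v ≡ M v u)
    × (∀ u → countTrue (map (M u) (allFin n)) ≡ 1)

{-# OPTIONS --safe #-}
-- The odd edges N of the paths of G′ and of G − V′ form a perfect matching, since these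
-- paths are odd, vertex-disjoint and cover V; only conditions (i), (v) and (viii) are
-- needed. If M is a perfect matching differing from N at u, walk from u following N and
-- M alternately. Each step is undone by the same matching, so the walk returns to u, and
-- its first return closes an N,Nᶜ-alternating cycle, which (viii) forbids.
module Submission where

open import Defs
open import Data.Nat using (ℕ; zero; suc; pred; _+_; _≤_; _<_; z≤n; s≤s; s<s)
open import Data.Nat.Properties using (n<1+n; +-suc; +-comm; m≤n+m; ≤-trans; ≤-pred; m≤n⇒∃[o]m+o≡n; m≤m+n)
open import Data.Bool using (Bool; true; false; not)
open import Data.Bool.Properties using (not-injective; not-involutive; not-¬; ¬-not) renaming (_≟_ to _≟ᵇ_)
open import Data.Fin using (Fin; toℕ; _≟_)
open import Data.Fin.Properties using (pigeonhole)
open import Data.List using (List; []; _∷_; _++_; _∷ʳ_; concat; map; length; applyUpTo; allFin)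
open import Data.List.Properties using (length-applyUpTo; applyUpTo-∷ʳ; concat-++)
open import Data.List.Membership.Propositional using (_∈_)
open import Data.List.Membership.Propositional.Properties
  using (∈-concat⁺′; ∈-concat⁻′; ∈-++⁺ˡ; ∈-++⁺ʳ; ∈-allFin)
open import Data.List.Relation.Unary.Any using (here; there)
open import Data.List.Relation.Unary.All as All using (All; _∷_)
import Data.List.Relation.Unary.All.Properties as All
open import Data.List.Relation.Unary.Unique.Propositional using (Unique)
import Data.List.Relation.Unary.Unique.Propositional.Properties as Unique
open import Data.List.Relation.Unary.AllPairs using (_∷_)
open import Data.Product using (Σ; ∃-syntax; _×_; _,_; proj₁; proj₂)
open import Data.Sum using (_⊎_; inj₁; inj₂)
open import Data.Empty using (⊥; ⊥-elim)
open import Function using (_∘_)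
open import Relation.Binary.PropositionalEquality
open import Relation.Nullary using (¬_; yes; no; does; contradiction)
open import Relation.Nullary.Decidable using (dec-true)
open import Relation.Unary using (Pred; Decidable)
open import Level using (0ℓ)

private
  variable
    A : Set
    a b x y z : A
    xs ys zs : List A

least-witness : {P : Pred ℕ 0ℓ} → Decidable P → ∀ {k} → P k →
                ∃[ m ] P m × (∀ {j} → j < m → ¬ P j)
least-witness P? p with P? 0
... | yes p₀ = 0 , p₀ , λ ()
least-witness P? {zero}  p | no ¬p₀ = contradiction p ¬p₀
least-witness P? {suc k} p | no ¬p₀ with least-witness (P? ∘ suc) p
... | m , pm , below = suc m , pm , λ { {zero} _ → ¬p₀ ; {suc j} (s<s j<m) → below j<m }

<⇒≡+suc : ∀ {a b} → a < b → ∃[ o ] b ≡ a + suc o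
<⇒≡+suc {a} a<b with o , a+1+o≡b ← m≤n⇒∃[o]m+o≡n a<b = o , trans (sym a+1+o≡b) (sym (+-suc a o))

Unique-++⇒disjoint : ∀ xs → Unique (xs ++ ys) → x ∈ xs → x ∈ ys → ⊥
Unique-++⇒disjoint (_ ∷ xs) (x∉ ∷ _) (here refl) x∈ys = All.lookup (All.++⁻ʳ xs x∉) x∈ys refl
Unique-++⇒disjoint (_ ∷ xs) (_ ∷ u)  (there x∈xs) x∈ys = Unique-++⇒disjoint xs u x∈xs x∈ys

Unique-++⁻ʳ : ∀ xs → Unique (xs ++ ys) → Unique ys
Unique-++⁻ʳ []       u       = u
Unique-++⁻ʳ (_ ∷ xs) (_ ∷ u) = Unique-++⁻ʳ xs u

Unique-concat⇒≡ : ∀ (L : List (List A)) → Unique (concat L) →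
                  ys ∈ L → zs ∈ L → x ∈ ys → x ∈ zs → ys ≡ zs
Unique-concat⇒≡ (_ ∷ L) u (here refl) (here refl) _ _ = refl
Unique-concat⇒≡ (ws ∷ L) u (here refl) (there j) x∈ws x∈zs =
  ⊥-elim (Unique-++⇒disjoint ws u x∈ws (∈-concat⁺′ x∈zs j))
Unique-concat⇒≡ (ws ∷ L) u (there i) (here refl) x∈ys x∈ws =
  ⊥-elim (Unique-++⇒disjoint ws u x∈ws (∈-concat⁺′ x∈ys i))
Unique-concat⇒≡ (ws ∷ L) u (there i) (there j) x∈ys x∈zs =
  Unique-concat⇒≡ L (Unique-++⁻ʳ ws u) i j x∈ys x∈zs

∈-pairs-∷ : ∀ {e : A × A} ys → e ∈ pairs ys → e ∈ pairs (x ∷ ys)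
∈-pairs-∷ (_ ∷ _) e∈ = there e∈

oddPairs⊆pairs : ∀ {e : A × A} xs → e ∈ oddPairs xs → e ∈ pairs xs
oddPairs⊆pairs (_ ∷ _ ∷ _) (here refl) = here refl
oddPairs⊆pairs (_ ∷ y ∷ r) (there e∈) = ∈-pairs-∷ (y ∷ r) (∈-pairs-∷ r (oddPairs⊆pairs r e∈))

∈-oddPairs⇒∈ : ∀ xs → (x , y) ∈ oddPairs xs → x ∈ xs × y ∈ xs
∈-oddPairs⇒∈ (_ ∷ _ ∷ _) (here refl) = here refl , there (here refl)
∈-oddPairs⇒∈ (_ ∷ _ ∷ r) (there e∈) =
  let x∈ , y∈ = ∈-oddPairs⇒∈ r e∈ in there (there x∈) , there (there y∈)

InE-oddPairs⇒∈ : ∀ xs → InE (oddPairs xs) x y → x ∈ xs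
InE-oddPairs⇒∈ xs (inj₁ e∈) = proj₁ (∈-oddPairs⇒∈ xs e∈)
InE-oddPairs⇒∈ xs (inj₂ e∈) = proj₂ (∈-oddPairs⇒∈ xs e∈)

InE-oddPairs-∷∷⁻ : ∀ {r : List A} → InE (oddPairs (a ∷ b ∷ r)) x y →
                   (x ≡ a × y ≡ b) ⊎ (x ≡ b × y ≡ a) ⊎ InE (oddPairs r) x y
InE-oddPairs-∷∷⁻ (inj₁ (here refl)) = inj₁ (refl , refl)
InE-oddPairs-∷∷⁻ (inj₂ (here refl)) = inj₂ (inj₁ (refl , refl))
InE-oddPairs-∷∷⁻ (inj₁ (there e∈))  = inj₂ (inj₂ (inj₁ e∈))
InE-oddPairs-∷∷⁻ (inj₂ (there e∈))  = inj₂ (inj₂ (inj₂ e∈))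

oddPairs-partner : ∀ xs → OddN (pathLength xs) → x ∈ xs → ∃[ y ] InE (oddPairs xs) x y
oddPairs-partner (a ∷ b ∷ _) _ (here refl)         = b , inj₁ (here refl)
oddPairs-partner (a ∷ b ∷ _) _ (there (here refl)) = a , inj₂ (here refl)
oddPairs-partner (_ ∷ _ ∷ c ∷ r) odd (there (there x∈)) with oddPairs-partner (c ∷ r) odd x∈
... | y , inj₁ e∈ = y , inj₁ (there e∈)
... | y , inj₂ e∈ = y , inj₂ (there e∈)

oddPairs-partner-unique : ∀ xs → Unique xs → InE (oddPairs xs) x y → InE (oddPairs xs) x z → y ≡ z
oddPairs-partner-unique []          _ (inj₁ ()) _
oddPairs-partner-unique []          _ (inj₂ ()) _
oddPairs-partner-unique (_ ∷ [])    _ (inj₁ ()) _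
oddPairs-partner-unique (_ ∷ [])    _ (inj₂ ()) _
oddPairs-partner-unique (a ∷ b ∷ r) ((a≢b ∷ a∉r) ∷ (b∉r ∷ u)) xy xz
  with InE-oddPairs-∷∷⁻ xy | InE-oddPairs-∷∷⁻ xz
... | inj₁ (refl , refl)        | inj₁ (_ , refl)        = refl
... | inj₂ (inj₁ (refl , refl)) | inj₂ (inj₁ (_ , refl)) = refl
... | inj₁ (refl , refl)        | inj₂ (inj₁ (a≡b , _))  = contradiction a≡b a≢b
... | inj₂ (inj₁ (refl , refl)) | inj₁ (b≡a , _)         = contradiction (sym b≡a) a≢b
... | inj₂ (inj₂ xy′)           | inj₂ (inj₂ xz′)        = oddPairs-partner-unique r u xy′ xz′
... | inj₁ (refl , _)           | inj₂ (inj₂ xz′)        = ⊥-elim (All.lookup a∉r (InE-oddPairs⇒∈ r xz′) refl)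
... | inj₂ (inj₁ (refl , _))    | inj₂ (inj₂ xz′)        = ⊥-elim (All.lookup b∉r (InE-oddPairs⇒∈ r xz′) refl)
... | inj₂ (inj₂ xy′)           | inj₁ (refl , _)        = ⊥-elim (All.lookup a∉r (InE-oddPairs⇒∈ r xy′) refl)
... | inj₂ (inj₂ xy′)           | inj₂ (inj₁ (refl , _)) = ⊥-elim (All.lookup b∉r (InE-oddPairs⇒∈ r xy′) refl)

cycPairs-applyUpTo : ∀ (f : ℕ → A) m → f (suc m) ≡ f 0 →
                     cycPairs (applyUpTo f (suc m)) ≡ applyUpTo (λ k → f k , f (suc k)) (suc m)
cycPairs-applyUpTo f m f-closes = begin
  pairs (applyUpTo f (suc m) ∷ʳ f 0)        ≡⟨ cong (λ z → pairs (applyUpTo f (suc m) ∷ʳ z)) f-closes ⟨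
  pairs (applyUpTo f (suc m) ∷ʳ f (suc m))  ≡⟨ cong pairs (applyUpTo-∷ʳ f (suc m)) ⟩
  pairs (applyUpTo f (suc (suc m)))                  ≡⟨ pairs-applyUpTo f (suc m) ⟩
  applyUpTo (λ k → f k , f (suc k)) (suc m)          ∎
  where
    open ≡-Reasoning
    pairs-applyUpTo : ∀ (g : ℕ → A) k → pairs (applyUpTo g (suc k)) ≡ applyUpTo (λ i → g i , g (suc i)) k
    pairs-applyUpTo g zero    = refl
    pairs-applyUpTo g (suc k) = cong ((g 0 , g 1) ∷_) (pairs-applyUpTo (g ∘ suc) k)

countTrue≡0⇒false : ∀ (f : A → Bool) xs → countTrue (map f xs) ≡ 0 → ∀ {b} → b ∈ xs → f b ≡ false
countTrue≡0⇒false f (x ∷ xs) c b∈ with f x in fx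
countTrue≡0⇒false f (x ∷ xs) c (here refl) | false = fx
countTrue≡0⇒false f (x ∷ xs) c (there b∈) | false = countTrue≡0⇒false f xs c b∈

false⇒countTrue≡0 : ∀ (f : A → Bool) xs → (∀ {b} → b ∈ xs → f b ≡ false) → countTrue (map f xs) ≡ 0
false⇒countTrue≡0 f []       _   = refl
false⇒countTrue≡0 f (x ∷ xs) all rewrite all (here refl) = false⇒countTrue≡0 f xs (all ∘ there)

countTrue≡1⇒unique : ∀ (f : A → Bool) xs → countTrue (map f xs) ≡ 1 →
                     ∃[ a ] f a ≡ true × (∀ {b} → b ∈ xs → f b ≡ true → b ≡ a)
countTrue≡1⇒unique f (x ∷ xs) c with f x in fx
... | true = x , fx , λ { (here refl) _ → refl
                        ; (there b∈) fb → contradiction (trans (sym fb) (countTrue≡0⇒false f xs (cong pred c) b∈)) λ () }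
... | false with countTrue≡1⇒unique f xs c
...   | a , fa , unique = a , fa , λ { (here refl) fb → contradiction (trans (sym fb) fx) λ ()
                                     ; (there b∈) fb → unique b∈ fb }

unique⇒countTrue≡1 : ∀ (f : A → Bool) xs → Unique xs → a ∈ xs → f a ≡ true →
                     (∀ {b} → f b ≡ true → b ≡ a) → countTrue (map f xs) ≡ 1
unique⇒countTrue≡1 f (x ∷ xs) (x∉ ∷ _) (here refl) fa unique rewrite fa =
  cong suc (false⇒countTrue≡0 f xs others-false)
  where
    others-false : ∀ {b} → b ∈ xs → f b ≡ false
    others-false {b} b∈ with f b in fb
    ... | true  = contradiction (sym (unique fb)) (All.lookup x∉ b∈)
    ... | false = refl
unique⇒countTrue≡1 f (x ∷ xs) (x∉ ∷ u) (there a∈) fa unique with f x in fx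
... | true  = contradiction (unique fx) (All.lookup x∉ a∈)
... | false = unique⇒countTrue≡1 f xs u a∈ fa unique

adjacent⇒≢ : ∀ {n} (G : Graph n) {x y : Fin n} → E G x y → x ≢ y
adjacent⇒≢ G {x} xy refl = contradiction (trans (sym xy) (Graph.adj-irr G x)) λ ()

record Pairing {n : ℕ} (G : Graph n) : Set where
  field
    mate            : Fin n → Fin n
    mate-involutive : ∀ x → mate (mate x) ≡ x
    mate-adjacent   : ∀ x → E G x (mate x)

matchingOf : ∀ {n} → (Fin n → Fin n) → Fin n → Fin n → Bool
matchingOf mate u v = does (mate u ≟ v)

module _ {n : ℕ} (mate : Fin n → Fin n) where

  matchingOf-mate : ∀ u → matchingOf mate u (mate u) ≡ true
  matchingOf-mate u = dec-true (mate u ≟ mate u) refl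

  matchingOf-true⇒mate : ∀ {u v} → matchingOf mate u v ≡ true → mate u ≡ v
  matchingOf-true⇒mate {u} {v} h with mate u ≟ v
  ... | yes mate-u≡v = mate-u≡v

module _ {n : ℕ} {G : Graph n} where

  matchingOf-isPerfect : (π : Pairing G) → IsPerfectMatching G (matchingOf (Pairing.mate π))
  matchingOf-isPerfect π = edges , symmetric , one-partner
    where
      open Pairing π
      edges : ∀ u v → matchingOf mate u v ≡ true → Graph.adj G u v ≡ true
      edges u v h with refl ← matchingOf-true⇒mate mate h = mate-adjacent u
      symmetric : ∀ u v → matchingOf mate u v ≡ matchingOf mate v u
      symmetric u v with mate u ≟ v | mate v ≟ u
      ... | yes _         | yes _    = refl
      ... | no _          | no _     = refl
      ... | yes refl      | no ¬mate = contradiction (mate-involutive u) ¬mate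
      ... | no ¬mate      | yes refl = contradiction (mate-involutive v) ¬mate
      one-partner : ∀ u → countTrue (map (matchingOf mate u) (allFin n)) ≡ 1
      one-partner u = unique⇒countTrue≡1 _ (allFin n) (Unique.allFin⁺ n) (∈-allFin (mate u))
                        (matchingOf-mate mate u) (sym ∘ matchingOf-true⇒mate mate)

  module _ {M : Fin n → Fin n → Bool} (PM : IsPerfectMatching G M) where
    private
      edges : ∀ u v → M u v ≡ true → Graph.adj G u v ≡ true
      edges = proj₁ PM
      symmetric : ∀ u v → M u v ≡ M v u
      symmetric = proj₁ (proj₂ PM)
      partner : ∀ u → ∃[ v ] M u v ≡ true × (∀ {w} → w ∈ allFin n → M u w ≡ true → w ≡ v)
      partner u = countTrue≡1⇒unique (M u) (allFin n) (proj₂ (proj₂ PM) u)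
      partner-unique : ∀ {u w} → M u w ≡ true → w ≡ proj₁ (partner u)
      partner-unique {u} {w} = proj₂ (proj₂ (partner u)) (∈-allFin w)

    perfectMatching⇒pairing : Pairing G
    perfectMatching⇒pairing = record
      { mate            = λ u → proj₁ (partner u)
      ; mate-involutive = λ u → sym (partner-unique (trans (symmetric _ u) (proj₁ (proj₂ (partner u)))))
      ; mate-adjacent   = λ u → edges u _ (proj₁ (proj₂ (partner u)))
      }

    perfectMatching≡matchingOf : ∀ u v → M u v ≡ matchingOf (Pairing.mate perfectMatching⇒pairing) u v
    perfectMatching≡matchingOf u v with M u v in Muv | proj₁ (partner u) ≟ v
    ... | true  | yes _      = refl
    ... | false | no _       = refl
    ... | true  | no ¬mate   = contradiction (sym (partner-unique Muv)) ¬mate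
    ... | false | yes refl   = contradiction (trans (sym (proj₁ (proj₂ (partner u)))) Muv) λ ()

module AlternatingWalk {n : ℕ} {G : Graph n} (π ρ : Pairing G)
                       (u : Fin n) (mates-differ : Pairing.mate π u ≢ Pairing.mate ρ u) where
  open Pairing π renaming (mate to p; mate-involutive to p-involutive; mate-adjacent to p-adjacent)
  open Pairing ρ renaming (mate to q; mate-involutive to q-involutive; mate-adjacent to q-adjacent)

  mateBy : Bool → Fin n → Fin n
  mateBy true  = p
  mateBy false = q

  mateBy-involutive : ∀ b x → mateBy b (mateBy b x) ≡ x
  mateBy-involutive true  = p-involutive
  mateBy-involutive false = q-involutive

  mateBy-adjacent : ∀ b x → E G x (mateBy b x)
  mateBy-adjacent true  = p-adjacent
  mateBy-adjacent false = q-adjacent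

  mateBy-moves : ∀ b x → mateBy b x ≢ x
  mateBy-moves b x = adjacent⇒≢ G (mateBy-adjacent b x) ∘ sym

  mateBy-preserves-matesDiffer : ∀ b x → p x ≢ q x → p (mateBy b x) ≢ q (mateBy b x)
  mateBy-preserves-matesDiffer true  x p≢q e = p≢q (begin
    p x           ≡⟨ q-involutive (p x) ⟨
    q (q (p x))   ≡⟨ cong q e ⟨
    q (p (p x))   ≡⟨ cong q (p-involutive x) ⟩
    q x           ∎) where open ≡-Reasoning
  mateBy-preserves-matesDiffer false x p≢q e = p≢q (begin
    p x           ≡⟨ cong p (q-involutive x) ⟨
    p (q (q x))   ≡⟨ cong p e ⟨
    p (p (q x))   ≡⟨ p-involutive (q x) ⟩
    q x           ∎) where open ≡-Reasoning

  usesπ : ℕ → Bool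
  usesπ zero    = true
  usesπ (suc k) = not (usesπ k)

  walk : ℕ → Fin n
  walk zero    = u
  walk (suc k) = mateBy (usesπ k) (walk k)

  walk-back : ∀ k → mateBy (usesπ k) (walk (suc k)) ≡ walk k
  walk-back k = mateBy-involutive (usesπ k) (walk k)

  walk-adjacent : ∀ k → E G (walk k) (walk (suc k))
  walk-adjacent k = mateBy-adjacent (usesπ k) (walk k)

  walk-matesDiffer : ∀ k → p (walk k) ≢ q (walk k)
  walk-matesDiffer zero    = mates-differ
  walk-matesDiffer (suc k) = mateBy-preserves-matesDiffer (usesπ k) (walk k) (walk-matesDiffer k)

  walk-shift : ∀ a {d} → walk a ≡ walk (a + d) → usesπ a ≡ usesπ (a + d) → walk 0 ≡ walk d
  walk-shift zero    e _ = e
  walk-shift (suc a) {d} e s = walk-shift a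
    (trans (sym (walk-back a)) (trans (cong₂ mateBy (not-injective s) e) (walk-back (a + d))))
    (not-injective s)

  -- A vertex visited twice with opposite parities forces, reading inwards from both
  -- visits, a repeated vertex one edge apart: a fixed point of p or q.
  walk-reflect : ∀ d {a b} → b ≡ d + a → usesπ a ≢ usesπ b → walk a ≢ walk b
  walk-reflect zero          refl ne _ = ne refl
  walk-reflect (suc zero)    {a} refl _ e = mateBy-moves (usesπ a) (walk a) (sym e)
  walk-reflect (suc (suc d)) {a} refl ne e = walk-reflect d (sym (+-suc d a)) ne′ e′
    where
      b₁ : ℕ
      b₁ = suc (d + a)
      usesπ-b₁ : usesπ b₁ ≡ usesπ a
      usesπ-b₁ = sym (trans (¬-not ne) (not-involutive (usesπ b₁)))
      e′ : walk (suc a) ≡ walk b₁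
      e′ = trans (cong₂ mateBy (sym usesπ-b₁) e) (walk-back b₁)
      ne′ : usesπ (suc a) ≢ usesπ b₁
      ne′ h = not-¬ refl (sym (trans h usesπ-b₁))

  sameVertex⇒sameParity : ∀ {a b} → a ≤ b → walk a ≡ walk b → usesπ a ≡ usesπ b
  sameVertex⇒sameParity {a} {b} a≤b e with usesπ a ≟ᵇ usesπ b
  ... | yes s = s
  ... | no ¬s with d , a+d≡b ← m≤n⇒∃[o]m+o≡n a≤b =
    contradiction e (walk-reflect d (trans (sym a+d≡b) (+-comm a d)) ¬s)

  walk-repeat : ∀ a d → walk a ≡ walk (a + d) → walk 0 ≡ walk d
  walk-repeat a d e = walk-shift a e (sameVertex⇒sameParity (m≤m+n a d) e)

  walk-returns : ∃[ k ] walk (suc k) ≡ walk 0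
  walk-returns with pigeonhole (n<1+n n) (walk ∘ toℕ)
  ... | i , j , i<j , walk-i≡walk-j with <⇒≡+suc i<j
  ...   | o , j≡i+1+o =
    o , sym (walk-repeat (toℕ i) (suc o) (trans walk-i≡walk-j (cong walk j≡i+1+o)))

  private
    first-return : ∃[ m ] walk (suc m) ≡ walk 0 × (∀ {j} → j < m → walk (suc j) ≢ walk 0)
    first-return = least-witness (λ k → walk (suc k) ≟ walk 0) {proj₁ walk-returns} (proj₂ walk-returns)

  period : ℕ
  period = proj₁ first-return

  walk-closes : walk (suc period) ≡ walk 0
  walk-closes = proj₁ (proj₂ first-return)

  walk-injective : ∀ {i j} → i < j → j ≤ period → walk i ≢ walk j
  walk-injective {i} i<j j≤period walk-i≡walk-j with o , refl ← <⇒≡+suc i<j =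
    proj₂ (proj₂ first-return) (≤-trans (m≤n+m (suc o) i) j≤period)
      (sym (walk-repeat i (suc o) walk-i≡walk-j))

  usesπ-period : usesπ (suc period) ≡ true
  usesπ-period = sym (sameVertex⇒sameParity {b = suc period} z≤n (sym walk-closes))

  2≤period : 2 ≤ period
  2≤period with period | walk-closes
  ... | zero        | closes = contradiction closes (mateBy-moves true u)
  ... | suc zero    | closes = contradiction (trans (sym (q-involutive (p u))) (cong q closes)) mates-differ
  ... | suc (suc _) | _      = s≤s (s≤s z≤n)

  module _ (Nr : VRel n) (Nr-mate : ∀ x → Nr x (p x)) (Nr⇒mate : ∀ {x y} → Nr x y → y ≡ p x) where

    walk-edge∈Nr : ∀ k → usesπ k ≡ true → Nr (walk k) (walk (suc k))
    walk-edge∈Nr k uses rewrite uses = Nr-mate (walk k)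

    walk-edge∉Nr : ∀ k → usesπ k ≡ false → ¬ Nr (walk k) (walk (suc k))
    walk-edge∉Nr k uses rewrite uses = walk-matesDiffer k ∘ sym ∘ Nr⇒mate

    walk-alternates : ∀ k → (Nr (walk k) (walk (suc k)) × ¬ Nr (walk (suc k)) (walk (suc (suc k))))
                          ⊎ (¬ Nr (walk k) (walk (suc k)) × Nr (walk (suc k)) (walk (suc (suc k))))
    walk-alternates k with usesπ k ≟ᵇ true
    ... | yes uses = inj₁ (walk-edge∈Nr k uses , walk-edge∉Nr (suc k) (cong not uses))
    ... | no ¬uses = inj₂ (walk-edge∉Nr k (¬-not ¬uses) , walk-edge∈Nr (suc k) (cong not (¬-not ¬uses)))

    alternatingCycle : ∃[ c ] AltCycle G Nr c
    alternatingCycle = cycle , long , distinct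
                     , subst (All _) (sym edges-of-cycle) (All.applyUpTo⁺₂ edge (suc period) walk-adjacent)
                     , subst (All _) (sym edge-pairs-of-cycle)
                         (All.applyUpTo⁺₂ (λ k → edge k , edge (suc k)) (suc period) walk-alternates)
      where
        cycle : List (Fin n)
        cycle = applyUpTo walk (suc period)
        long : 3 ≤ length cycle
        long = subst (3 ≤_) (sym (length-applyUpTo walk (suc period))) (s≤s 2≤period)
        distinct : Unique cycle
        distinct = Unique.applyUpTo⁺₁ walk (suc period) λ i<j j≤period → walk-injective i<j (≤-pred j≤period)
        edge : ℕ → Fin n × Fin n
        edge k = walk k , walk (suc k)
        edges-of-cycle : cycPairs cycle ≡ applyUpTo edge (suc period)
        edges-of-cycle = cycPairs-applyUpTo walk period walk-closes
        edge-pairs-of-cycle : cycPairs (cycPairs cycle) ≡ applyUpTo (λ k → edge k , edge (suc k)) (suc period)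
        edge-pairs-of-cycle = trans (cong cycPairs edges-of-cycle)
          (cycPairs-applyUpTo edge period (cong₂ _,_ walk-closes (cong₂ mateBy usesπ-period walk-closes)))

module _ {n : ℕ} {G : Graph n} (π : Pairing G) where
  open Pairing

  uniquePairing⇒uniqueMatching : (∀ (ρ : Pairing G) u → mate ρ u ≡ mate π u) →
                                 ∀ {M} → IsPerfectMatching G M → ∀ u v → M u v ≡ matchingOf (mate π) u v
  uniquePairing⇒uniqueMatching unique PM u v =
    trans (perfectMatching≡matchingOf {G = G} PM u v)
          (cong (λ w → does (w ≟ v)) (unique (perfectMatching⇒pairing {G = G} PM) u))

  altCycleFree⇒uniquePairing : (Nr : VRel n) → (∀ x → Nr x (mate π x)) → (∀ {x y} → Nr x y → y ≡ mate π x) →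
                               (∀ c → ¬ AltCycle G Nr c) → ∀ (ρ : Pairing G) u → mate ρ u ≡ mate π u
  altCycleFree⇒uniquePairing Nr Nr-mate Nr⇒mate altCycleFree ρ u with mate ρ u ≟ mate π u
  ... | yes same = same
  ... | no differ = ⊥-elim (altCycleFree (proj₁ cycle) (proj₂ cycle))
    where
      cycle : ∃[ c ] AltCycle G Nr c
      cycle = AlternatingWalk.alternatingCycle π ρ u (differ ∘ sym) Nr Nr-mate Nr⇒mate

module OddPathCover {n : ℕ} (G : Graph n) (L : List (List (Fin n)))
                    (disjoint : Unique (concat L)) (paths : All (IsPathIn (E G)) L)
                    (odd : All (OddN ∘ pathLength) L) (cover : ∀ v → ∃[ P ] P ∈ L × v ∈ P) where

  OddEdge : VRel n
  OddEdge x y = ∃[ P ] P ∈ L × InE (oddPairs P) x y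

  OddEdge-sym : ∀ {x y} → OddEdge x y → OddEdge y x
  OddEdge-sym (P , P∈L , inj₁ e∈) = P , P∈L , inj₂ e∈
  OddEdge-sym (P , P∈L , inj₂ e∈) = P , P∈L , inj₁ e∈

  OddEdge⇒E : ∀ {x y} → OddEdge x y → E G x y
  OddEdge⇒E (P , P∈L , inj₁ e∈) = All.lookup (proj₂ (All.lookup paths P∈L)) (oddPairs⊆pairs P e∈)
  OddEdge⇒E {x} {y} (P , P∈L , inj₂ e∈) =
    trans (Graph.adj-sym G x y) (All.lookup (proj₂ (All.lookup paths P∈L)) (oddPairs⊆pairs P e∈))

  OddEdge-functional : ∀ {x y z} → OddEdge x y → OddEdge x z → y ≡ z
  OddEdge-functional (P , P∈L , xy) (P′ , P′∈L , xz)
    with refl ← Unique-concat⇒≡ L disjoint P∈L P′∈L (InE-oddPairs⇒∈ P xy) (InE-oddPairs⇒∈ P′ xz) =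
    oddPairs-partner-unique P (proj₁ (All.lookup paths P∈L)) xy xz

  oddPartner : ∀ x → ∃[ y ] OddEdge x y
  oddPartner x with P , P∈L , x∈P ← cover x with y , xy ← oddPairs-partner P (All.lookup odd P∈L) x∈P =
    y , P , P∈L , xy

  pairing : Pairing G
  pairing = record
    { mate            = proj₁ ∘ oddPartner
    ; mate-involutive = λ x → OddEdge-functional (proj₂ (oddPartner _)) (OddEdge-sym (proj₂ (oddPartner x)))
    ; mate-adjacent   = λ x → OddEdge⇒E (proj₂ (oddPartner x))
    }

  OddEdge-mate : ∀ x → OddEdge x (Pairing.mate pairing x)
  OddEdge-mate x = proj₂ (oddPartner x)

  OddEdge⇒mate : ∀ {x y} → OddEdge x y → y ≡ Pairing.mate pairing x
  OddEdge⇒mate xy = OddEdge-functional xy (OddEdge-mate _)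

module _ {n : ℕ} {G : Graph n} {Ps Qs : List (List (Fin n))} (W : SkeletonWitness G Ps Qs) where
  open SkeletonWitness W
  open import Data.List.Membership.DecPropositional (_≟_ {n}) using (_∈?_)

  skeleton-disjoint : Unique (concat (Ps ++ Qs))
  skeleton-disjoint = subst Unique (concat-++ Ps Qs)
    (Unique.++⁺ G'-disjoint Q-disjoint λ (v∈Ps , v∈Qs) → proj₁ (Q-cover _) v∈Qs v∈Ps)

  skeleton-cover : ∀ v → ∃[ P ] P ∈ Ps ++ Qs × v ∈ P
  skeleton-cover v with v ∈? concat Ps
  ... | yes v∈Ps = let P , v∈P , P∈Ps = ∈-concat⁻′ Ps v∈Ps in P , ∈-++⁺ˡ P∈Ps , v∈P
  ... | no  v∉Ps = let Q , v∈Q , Q∈Qs = ∈-concat⁻′ Qs (proj₂ (Q-cover v) v∉Ps) in Q , ∈-++⁺ʳ Ps Q∈Qs , v∈Q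

  skeleton-oddPathCover : Σ (Pairing G) λ π → (∀ x → N G Ps Qs x (Pairing.mate π x))
                                            × (∀ {x y} → N G Ps Qs x y → y ≡ Pairing.mate π x)
  skeleton-oddPathCover = pairing , OddEdge-mate , OddEdge⇒mate
    where open OddPathCover G (Ps ++ Qs) skeleton-disjoint (All.++⁺ G'-paths Q-paths)
                               (All.++⁺ G'-odd Q-odd) skeleton-cover

mainTheorem3 : {n : ℕ} (G : Graph n) → IsSkeleton G →
    Σ (Fin n → Fin n → Bool) (λ M → IsPerfectMatching G M ×
      ((M' : Fin n → Fin n → Bool) → IsPerfectMatching G M' → ∀ u v → M' u v ≡ M u v))
mainTheorem3 G (_ , _ , _ , Ps , Qs , W)
  with π , N-mate , N⇒mate ← skeleton-oddPathCover W =
  matchingOf (Pairing.mate π) , matchingOf-isPerfect π , λ M′ →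
    uniquePairing⇒uniqueMatching π
      (altCycleFree⇒uniquePairing π (N G Ps Qs) N-mate N⇒mate (SkeletonWitness.noAltCycle W))
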